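{- Let $S$ be an AMAS, $A\subseteq\mathbb{A}\mathrm{gt}$ a coalition, $\sigma_A$ a joint strategy, and $g$ a global state of $\mathrm{IIS}^{\epsilon}(S)$. If $\pi=g_0e_0g_1e_1\dots$ belongs to the reactive outcome $out^{EL}_{\mathrm{IIS}^{\epsilon}(S)}(g,\sigma_A)$ and $\epsilon$ occurs on $\pi$, then there is $i$ such that $e_j\neq\epsilon$ for all $j<i$ and $e_j=\epsilon$ for all $j\ge i$; i.e., the only possible occurrence of $\epsilon$ is as an infinite sequence of $\epsilon$-transitions following a finite prefix of non-$\epsilon$ transitions.
   Context: An AMAS $S$ consists of agents $\mathbb{A}\mathrm{gt}=\{1,\dots,n\}$; each agent $i$ has a finite set of local states $L_i$, an initial state $\iota_i$, a finite set of events $\Sigma_i$, a repertoire $R_i:L_i\to 2^{\Sigma_i}\setminus\{\emptyset\}$, and a partial local transition function $T_i:L_i\times\Sigma_i\rightharpoonup L_i$ defined iff $e\in R_i(l)$. $Agent(e)=\{i\mid e\in\Sigma_i\}$. The model $\mathrm{IIS}(S)$ has global states (tuples of local states) reachable from $(\iota_1,\dots,\iota_n)$ via $T(g,e)=g'$ iff $T_i(g^i,e)=g'^i$ for $i\in Agent(e)$ and $g'^i=g^i$ otherwise; $enabled(g)$ is the set of events $e$ with $T(g,e)$ defined, and $T$ is assumed serial. A strategy of agent $i$ is $\sigma_i:L_i\to\Sigma_i$ with $\sigma_i(l)\in R_i(l)$; $\sigma_A(g)=(\sigma_i(g^i))_{i\in A}$. For choices $\vec e_A=(e_i)_{i\in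 A}$, $e_i\in R_i(g^i)$, $enabled_{\mathrm{IIS}(S)}(g,\vec e_A)$ is the set of $b\in enabled(g)$ with $b=e_i$ for all $i\in Agent(b)\cap A$ and $b\in R_i(g^i)$ for all $i\in Agent(b)\setminus A$. The undeadlocked model $\mathrm{IIS}^{\epsilon}(S)$ adds a fresh event $\epsilon$ ($Agent(\epsilon)=\emptyset$) as a self-loop $g\xrightarrow{\epsilon}g$ at every state $g$ where some coalition has a choice tuple $\vec e_A$ with $enabled_{\mathrm{IIS}(S)}(g,\vec e_A)=\emptyset$; for such tuples $enabled_{\mathrm{IIS}^{\epsilon}(S)}(g,\vec e_A)=\{\epsilon\}$, otherwise it equals $enabled_{\mathrm{IIS}(S)}(g,\vec e_A)$. A path is an infinite sequence $g_0e_0g_1e_1\dots$ with $g_k\xrightarrow{e_k}g_{k+1}$. The outcome $out(g,\sigma_A)$ is the set of paths with $g_0=g$ and $e_k\in enabled(g_k,\sigma_A(g_k))$ for all $k$. A path is opponent-reactive for $\sigma_A$ iff for all $k$, $e_k=\epsilon$ implies $enabled(g_k,\sigma_A(g_k))=\{\epsilon\}$; the reactive outcome $out^{EL}(g,\sigma_A)$ is the set of opponent-reactive paths in $out(g,\sigma_A)$. -}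

module Defs where

open import Data.Nat using (ℕ; zero; suc; _<_; _≥_)
open import Data.Fin using (Fin)
open import Data.Fin.Subset using (Subset; _∈_; _∉_; _⊆_; Nonempty)
open import Data.Maybe using (Maybe; just; nothing)
open import Data.Product using (Σ; ∃; _×_; _,_; proj₁; proj₂)
open import Relation.Binary.PropositionalEquality using (_≡_)
open import Relation.Nullary using (¬_)

record AMAS (n m : ℕ) : Set where
  field
    nL     : Fin n → ℕ
    ι      : (i : Fin n) → Fin (nL i)
    Σᵢ     : Fin n → Subset m
    -- every event belongs to some agent (the global alphabet is ⋃ Σᵢ)
    cover  : (e : Fin m) → ∃ λ i → e ∈ Σᵢ i
    R      : (i : Fin n) → Fin (nL i) → Subset m
    R⊆Σ    : ∀ i l → R i l ⊆ Σᵢ i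
    R≠∅    : ∀ i l → Nonempty (R i l)
    T      : (i : Fin n) → Fin (nL i) → Fin m → Maybe (Fin (nL i))
    T-def  : ∀ i l e → e ∈ R i l → ∃ λ l' → T i l e ≡ just l'
    T-dom  : ∀ i l e l' → T i l e ≡ just l' → e ∈ R i l

module _ {n m : ℕ} (S : AMAS n m) where
  open AMAS S

  GState : Set
  GState = (i : Fin n) → Fin (nL i)

  initial : GState
  initial = ι

  InAgent : Fin m → Fin n → Set
  InAgent e i = e ∈ Σᵢ i

  Step : GState → Fin m → GState → Set
  Step g e g' = ∀ i → (InAgent e i → T i (g i) e ≡ just (g' i))
                    × (¬ InAgent e i → g' i ≡ g i)

  Enabled : GState → Fin m → Set
  Enabled g e = ∃ λ g' → Step g e g'

  data Reachable : GState → Set where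
    r-init : Reachable initial
    r-step : ∀ {g e g'} → Reachable g → Step g e g' → Reachable g'

  Serial : Set
  Serial = ∀ g → Reachable g → ∃ λ e → Enabled g e

  Choice : Subset n → GState → Set
  Choice A g = (i : Fin n) → i ∈ A → Σ (Fin m) λ e → e ∈ R i (g i)

  EnabledIIS : (A : Subset n) (g : GState) → Choice A g → Fin m → Set
  EnabledIIS A g c b =
      Enabled g b
    × (∀ i (iA : i ∈ A) → InAgent b i → b ≡ proj₁ (c i iA))
    × (∀ i → InAgent b i → i ∉ A → b ∈ R i (g i))

  -- events of IIS^ε(S): nothing = ε, just e = e
  EventE : Set
  EventE = Maybe (Fin m)

  EpsLoop : GState → Set
  EpsLoop g = ∃ λ (B : Subset n) → Σ (Choice B g) λ c → ∀ b → ¬ EnabledIIS B g c b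

  StepE : GState → EventE → GState → Set
  StepE g (just e) g' = Step g e g'
  StepE g nothing  g' = (g' ≡ g) × EpsLoop g

  data ReachableE : GState → Set where
    re-init : ReachableE initial
    re-step : ∀ {g e g'} → ReachableE g → StepE g e g' → ReachableE g'

  EnabledE : (A : Subset n) (g : GState) → Choice A g → EventE → Set
  EnabledE A g c (just b) = EnabledIIS A g c b
  EnabledE A g c nothing  = ∀ b → ¬ EnabledIIS A g c b

  EnabledIsEps : (A : Subset n) (g : GState) → Choice A g → Set
  EnabledIsEps A g c = EnabledE A g c nothing × (∀ x → EnabledE A g c x → x ≡ nothing)

  Strategy : Fin n → Set
  Strategy i = Σ (Fin (nL i) → Fin m) λ f → ∀ l → f l ∈ R i l

  JointStrategy : Subset n → Set
  JointStrategy A = (i : Fin n) → i ∈ A → Strategy i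

  applyJS : {A : Subset n} → JointStrategy A → (g : GState) → Choice A g
  applyJS σ g i iA = proj₁ (σ i iA) (g i) , proj₂ (σ i iA) (g i)

  record PathE : Set where
    field
      st    : ℕ → GState
      ev    : ℕ → EventE
      steps : ∀ k → StepE (st k) (ev k) (st (suc k))
  open PathE public

  InOut : (A : Subset n) → JointStrategy A → GState → PathE → Set
  InOut A σ g π = (st π 0 ≡ g)
    × (∀ k → EnabledE A (st π k) (applyJS σ (st π k)) (ev π k))

  OpponentReactive : (A : Subset n) → JointStrategy A → PathE → Set
  OpponentReactive A σ π =
    ∀ k → ev π k ≡ nothing → EnabledIsEps A (st π k) (applyJS σ (st π k))

  InOutEL : (A : Subset n) → JointStrategy A → GState → PathE → Set
  InOutEL A σ g π = InOut A σ g π × OpponentReactive A σ π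

-- An ε-transition is a self-loop, so the state after it is the state before it
-- and the next event is again enabled there under the same choice σ_A(g).
-- Opponent-reactivity says that at a state where ε is taken, ε is the only
-- event enabled under σ_A; hence the next event is ε as well. So ε is absorbing
-- along a reactive path, and the prefix before it ends at the first ε.
module Submission where

open import Defs
open import Data.Nat using (ℕ; suc; _<_; _≤_; _≥_; _≤′_; ≤′-refl; ≤′-step)
open import Data.Nat.Properties using (anyUpTo?; ≤⇒≤′)
open import Data.Nat.Induction using (<-rec)
open import Data.Fin using () renaming (_≟_ to _≟ᶠ_)
open import Data.Fin.Subset using (Subset)
open import Data.Maybe using (nothing)
open import Data.Maybe.Properties using (≡-dec)
open import Data.Product using (∃; _×_; _,_; proj₁; proj₂)
open import Relation.Binary.PropositionalEquality using (_≡_; _≢_; subst)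
open import Relation.Nullary using (¬_; yes; no)
open import Relation.Unary using (Pred; Decidable)

module _ {p} {P : Pred ℕ p} where

  least-witness : Decidable P → ∀ {k} → P k →
                  ∃ λ i → (∀ j → j < i → ¬ P j) × P i
  least-witness P? {k} = <-rec (λ k → P k → ∃ λ i → (∀ j → j < i → ¬ P j) × P i) search k
    where
    search : ∀ k → (∀ {j} → j < k → P j → ∃ λ i → (∀ j → j < i → ¬ P j) × P i) →
             P k → ∃ λ i → (∀ j → j < i → ¬ P j) × P i
    search k smaller Pk with anyUpTo? P? k
    ... | yes (j , j<k , Pj) = smaller j<k Pj
    ... | no ¬below          = k , (λ j j<k Pj → ¬below (j , j<k , Pj)) , Pk

  suc-closed⇒≤-closed : (∀ {j} → P j → P (suc j)) → ∀ {i j} → i ≤ j → P i → P j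
  suc-closed⇒≤-closed P-suc i≤j = go (≤⇒≤′ i≤j)
    where
    go : ∀ {i j} → i ≤′ j → P i → P j
    go ≤′-refl        Pi = Pi
    go (≤′-step i≤′j) Pi = P-suc (go i≤′j Pi)

module _ {n m} (S : AMAS n m) where

  ε-step-stays : (π : PathE S) → ∀ {j} → ev π j ≡ nothing → st π (suc j) ≡ st π j
  ε-step-stays π {j} εⱼ =
    proj₁ (subst (λ e → StepE S (st π j) e (st π (suc j))) εⱼ (steps π j))

  ε-absorbing : ∀ A σ g (π : PathE S) → InOutEL S A σ g π →
                ∀ {j} → ev π j ≡ nothing → ev π (suc j) ≡ nothing
  ε-absorbing A σ _ π ((_ , enabled) , reactive) {j} εⱼ =
    proj₂ (reactive j εⱼ) (ev π (suc j)) next-enabled-at-j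
    where
    next-enabled-at-j : EnabledE S A (st π j) (applyJS S σ (st π j)) (ev π (suc j))
    next-enabled-at-j =
      subst (λ s → EnabledE S A s (applyJS S σ s) (ev π (suc j)))
            (ε-step-stays π εⱼ) (enabled (suc j))

mainTheorem2 : ∀ {n m} (S : AMAS n m) → Serial S →
    (A : Subset n) (σ : JointStrategy S A) (g : GState S) → ReachableE S g →
    (π : PathE S) → InOutEL S A σ g π →
    (∃ λ k → ev π k ≡ nothing) →
    ∃ λ i → (∀ j → j < i → ev π j ≢ nothing) × (∀ j → j ≥ i → ev π j ≡ nothing)
mainTheorem2 S _ A σ g _ π reactive-outcome (_ , εₖ)
  with least-witness (λ j → ≡-dec _≟ᶠ_ (ev π j) nothing) εₖ
... | i , no-ε-before-i , εᵢ =
  i , no-ε-before-i ,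
  λ j i≤j → suc-closed⇒≤-closed (ε-absorbing S A σ g π reactive-outcome) i≤j εᵢ
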